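{- Let $n$ be a non-negative integer and $m$ a positive integer. Then \[ \sum_{k=0}^{2n}(-1)^k k^m\binom{2n}{k}^3 = \sum_{k=n-m+1}^{n}(-1)^k\binom{2n+k}{2k}\binom{2k}{k}\binom{2n-k}{k}\sum_{p=0}^{2(n-k)}(-1)^p\binom{2(n-k)}{p}(k+p)^m. \] In particular, \[ \sum_{k=0}^{2n}(-1)^k k\binom{2n}{k}^3=(-1)^n n\binom{2n}{n}\binom{3n}{n},\qquad \sum_{k=0}^{2n}(-1)^k k^2\binom{2n}{k}^3=(-1)^n\frac23 n^2\binom{2n}{n}\binom{3n}{n}. \]
   Context: All binomial coefficients here have integer arguments; $\binom ab$ is the usual binomial coefficient, taken to be $0$ when $b<0$ or $b>a\ge 0$ (so summands with $k<0$ in the outer sum vanish). -}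

module Defs where

open import Data.Nat using (ℕ; zero; suc; _+_; _∸_)
open import Data.Integer using (ℤ; 0ℤ; +_; -_)
import Data.Integer as ℤ

-- Σ[ k = a .. b ] f k : sum of f k over natural numbers a ≤ k ≤ b
-- (empty, i.e. 0, when b < a).  Implemented as Σ_{i=0}^{b-a} f (a + i).
sumFromTo : ℕ → ℕ → (ℕ → ℤ) → ℤ
sumFromTo a b f = go (suc b ∸ a)
  where
  go : ℕ → ℤ
  go zero    = 0ℤ
  go (suc j) = go j ℤ.+ f (a + j)

sign : ℕ → ℤ
sign zero    = + 1
sign (suc k) = - sign k

module Submission where

-- Two applications of Vandermonde's convolution give
--   C(2n,k)² = Σ_j C(k,j) C(2n−k,j) C(2n+j,j),
-- which turns the left-hand side into a double sum over k and j. After exchanging the sums and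
-- writing k = j + p, the product C(2n,k) C(k,j) C(2n−k,j) C(2n+j,j) regroups as
-- M(2n,j) C(2(n−j),p) with M(N,j) = C(N+j,2j) C(2j,j) C(N−j,j) = (N+j)! / (j!³ (N−2j)!),
-- so the inner sum over p is Σ_p (−1)^p C(2(n−j),p) (j+p)^m, a finite difference of order
-- 2(n−j) of a polynomial of degree m. It vanishes when 2(n−j) > m, and M(2n,j) vanishes when
-- j > n, which leaves the range n−m < j ≤ n. For m = 1 only j = n survives; for m = 2 the
-- terms j = n−1 and j = n combine through 6 M(2n,n−1) = n² M(2n,n).

module BinomialCoefficients where
  open import Data.Nat
  open import Data.Nat.Properties
  open import Data.Nat.Combinatorics
  open import Data.Nat.DivMod using (m/n*n≡m)
  open import Data.Nat.Tactic.RingSolver using (solve-∀)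
  open import Relation.Nullary using (yes; no)
  open import Relation.Binary.PropositionalEquality
  open ≡-Reasoning

  m<n∸o⇒o+m<n : ∀ {m} n o → m < n ∸ o → o + m < n
  m<n∸o⇒o+m<n n       zero    m<n   = m<n
  m<n∸o⇒o+m<n (suc n) (suc o) m<n∸o = s≤s (m<n∸o⇒o+m<n n o m<n∸o)

  2*n∸j∸j≡2*[n∸j] : ∀ n j → 2 * n ∸ j ∸ j ≡ 2 * (n ∸ j)
  2*n∸j∸j≡2*[n∸j] n j = begin
    2 * n ∸ j ∸ j   ≡⟨ ∸-+-assoc (2 * n) j j ⟩
    2 * n ∸ (j + j) ≡⟨ cong (λ x → 2 * n ∸ (j + x)) (+-identityʳ j) ⟨
    2 * n ∸ 2 * j   ≡⟨ *-distribˡ-∸ 2 n j ⟨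
    2 * (n ∸ j)     ∎

  2*n∸n≡n : ∀ n → 2 * n ∸ n ≡ n
  2*n∸n≡n n = trans (m+n∸m≡n n (n + 0)) (+-identityʳ n)

  nCk*[k!*[n∸k]!]≡n! : ∀ {n k} → k ≤ n → (n C k) * (k ! * (n ∸ k) !) ≡ n !
  nCk*[k!*[n∸k]!]≡n! {n} {k} k≤n = begin
    (n C k) * (k ! * (n ∸ k) !)                ≡⟨ cong (_* (k ! * (n ∸ k) !)) (nCk≡n!/k![n-k]! k≤n) ⟩
    n ! / (k ! * (n ∸ k) !) * (k ! * (n ∸ k) !) ≡⟨ m/n*n≡m (k![n∸k]!∣n! k≤n) ⟩
    n !                                        ∎
    where instance _ = k !* (n ∸ k) !≢0

  [m+n]Cm≡[m+n]Cn : ∀ m n → (m + n) C m ≡ (m + n) C n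
  [m+n]Cm≡[m+n]Cn m n = trans (nCk≡nC[n∸k] (m≤m+n m n)) (cong ((m + n) C_) (m+n∸m≡n m n))

  nCi*[n∸i]Ct≡0 : ∀ n i t → n < i + t → (n C i) * ((n ∸ i) C t) ≡ 0
  nCi*[n∸i]Ct≡0 n i t n<i+t with i ≤? n
  ... | yes i≤n = begin
    (n C i) * ((n ∸ i) C t) ≡⟨ cong ((n C i) *_) (k>n⇒nCk≡0 n∸i<t) ⟩
    (n C i) * 0             ≡⟨ *-zeroʳ (n C i) ⟩
    0                       ∎
    where n∸i<t = subst (n ∸ i <_) (m+n∸m≡n i t) (∸-monoˡ-< n<i+t i≤n)
  ... | no i≰n = cong (_* ((n ∸ i) C t)) (k>n⇒nCk≡0 (≰⇒> i≰n))

  nCi*[n∸i]Ct≡nC[i+t]*[i+t]Ci : ∀ n i t → (n C i) * ((n ∸ i) C t) ≡ (n C (i + t)) * ((i + t) C i)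
  nCi*[n∸i]Ct≡nC[i+t]*[i+t]Ci n i t with i + t ≤? n
  ... | no i+t≰n = trans (nCi*[n∸i]Ct≡0 n i t n<i+t) (sym (cong (_* ((i + t) C i)) (k>n⇒nCk≡0 n<i+t)))
    where n<i+t = ≰⇒> i+t≰n
  ... | yes i+t≤n = *-cancelʳ-≡ _ _ (i ! * t ! * r !) {{i!t!r!≢0}} (trans left (sym right))
    where
    r = n ∸ (i + t)
    i!t!r!≢0 = m*n≢0 _ _ {{i !* t !≢0}} {{r !≢0}}
    rearrangeˡ : ∀ a b x y z → a * b * (x * y * z) ≡ a * (x * (b * (y * z)))
    rearrangeˡ = solve-∀
    rearrangeʳ : ∀ a b x y z → a * b * (x * y * z) ≡ a * (b * (x * y) * z)
    rearrangeʳ = solve-∀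
    left : (n C i) * ((n ∸ i) C t) * (i ! * t ! * r !) ≡ n !
    left = begin
      (n C i) * ((n ∸ i) C t) * (i ! * t ! * r !)     ≡⟨ rearrangeˡ (n C i) _ (i !) (t !) (r !) ⟩
      (n C i) * (i ! * (((n ∸ i) C t) * (t ! * r !))) ≡⟨ cong (λ x → (n C i) * (i ! * x)) inner ⟩
      (n C i) * (i ! * (n ∸ i) !)                     ≡⟨ nCk*[k!*[n∸k]!]≡n! (m+n≤o⇒m≤o i i+t≤n) ⟩
      n !                                             ∎
      where
      inner : ((n ∸ i) C t) * (t ! * r !) ≡ (n ∸ i) !
      inner = subst (λ x → ((n ∸ i) C t) * (t ! * x !) ≡ (n ∸ i) !) (∸-+-assoc n i t)
        (nCk*[k!*[n∸k]!]≡n! (m+n≤o⇒m≤o∸n t (subst (_≤ n) (+-comm i t) i+t≤n)))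
    right : (n C (i + t)) * ((i + t) C i) * (i ! * t ! * r !) ≡ n !
    right = begin
      (n C (i + t)) * ((i + t) C i) * (i ! * t ! * r !)   ≡⟨ rearrangeʳ (n C (i + t)) _ (i !) (t !) (r !) ⟩
      (n C (i + t)) * (((i + t) C i) * (i ! * t !) * r !) ≡⟨ cong (λ x → (n C (i + t)) * (x * r !)) inner ⟩
      (n C (i + t)) * ((i + t) ! * r !)                   ≡⟨ nCk*[k!*[n∸k]!]≡n! i+t≤n ⟩
      n !                                                 ∎
      where
      inner : ((i + t) C i) * (i ! * t !) ≡ (i + t) !
      inner = subst (λ x → ((i + t) C i) * (i ! * x !) ≡ (i + t) !) (m+n∸m≡n i t)
        (nCk*[k!*[n∸k]!]≡n! (m≤m+n i t))

  nCi*[n∸i]Ct≡nCt*[n∸t]Ci : ∀ n i t → (n C i) * ((n ∸ i) C t) ≡ (n C t) * ((n ∸ t) C i)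
  nCi*[n∸i]Ct≡nCt*[n∸t]Ci n i t = begin
    (n C i) * ((n ∸ i) C t)       ≡⟨ nCi*[n∸i]Ct≡nC[i+t]*[i+t]Ci n i t ⟩
    (n C (i + t)) * ((i + t) C i) ≡⟨ cong₂ _*_ (cong (n C_) (+-comm i t)) [i+t]Ci≡[t+i]Ct ⟩
    (n C (t + i)) * ((t + i) C t) ≡⟨ nCi*[n∸i]Ct≡nC[i+t]*[i+t]Ci n t i ⟨
    (n C t) * ((n ∸ t) C i)       ∎
    where
    [i+t]Ci≡[t+i]Ct : (i + t) C i ≡ (t + i) C t
    [i+t]Ci≡[t+i]Ct = trans ([m+n]Cm≡[m+n]Cn i t) (cong (_C t) (+-comm i t))

  [1+k]*[1+n]C[1+k]≡[1+n]*nCk : ∀ n k → suc k * (suc n C suc k) ≡ suc n * (n C k)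
  [1+k]*[1+n]C[1+k]≡[1+n]*nCk n k = begin
    suc k * (suc n C suc k)       ≡⟨ *-comm (suc k) _ ⟩
    (suc n C suc k) * suc k       ≡⟨ cong ((suc n C suc k) *_) (nC1≡n (suc k)) ⟨
    (suc n C suc k) * (suc k C 1) ≡⟨ nCi*[n∸i]Ct≡nC[i+t]*[i+t]Ci (suc n) 1 k ⟨
    (suc n C 1) * (n C k)         ≡⟨ cong (_* (n C k)) (nC1≡n (suc n)) ⟩
    suc n * (n C k)               ∎

  multinomial : ℕ → ℕ → ℕ
  multinomial N j = ((N + j) C (2 * j)) * ((2 * j) C j) * ((N ∸ j) C j)

  multinomial-factorial : ∀ N j → j ≤ N ∸ j →
    multinomial N j * (j ! * j ! * j ! * (N ∸ j ∸ j) !) ≡ (N + j) !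
  multinomial-factorial N j j≤N∸j = begin
    multinomial N j * (j ! * j ! * j ! * (N ∸ j ∸ j) !)
      ≡⟨ rearrange ((N + j) C (2 * j)) ((2 * j) C j) ((N ∸ j) C j) (j !) ((N ∸ j ∸ j) !) ⟩
    ((N + j) C (2 * j)) * (((2 * j) C j) * (j ! * j !)) * (((N ∸ j) C j) * (j ! * (N ∸ j ∸ j) !))
      ≡⟨ cong₂ (λ x y → ((N + j) C (2 * j)) * x * y)
               [2j]Cj*j!*j!≡[2j]! (nCk*[k!*[n∸k]!]≡n! j≤N∸j) ⟩
    ((N + j) C (2 * j)) * (2 * j) ! * (N ∸ j) !
      ≡⟨ *-assoc ((N + j) C (2 * j)) _ _ ⟩
    ((N + j) C (2 * j)) * ((2 * j) ! * (N ∸ j) !)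
      ≡⟨ subst (λ x → ((N + j) C (2 * j)) * ((2 * j) ! * x !) ≡ (N + j) !) N+j∸2j≡N∸j
           (nCk*[k!*[n∸k]!]≡n! 2j≤N+j) ⟩
    (N + j) ! ∎
    where
    rearrange : ∀ c₁ c₂ c₃ x y →
      c₁ * c₂ * c₃ * (x * x * x * y) ≡ c₁ * (c₂ * (x * x)) * (c₃ * (x * y))
    rearrange = solve-∀
    [2j]Cj*j!*j!≡[2j]! : ((2 * j) C j) * (j ! * j !) ≡ (2 * j) !
    [2j]Cj*j!*j!≡[2j]! = subst (λ x → ((2 * j) C j) * (j ! * x !) ≡ (2 * j) !) (2*n∸n≡n j)
      (nCk*[k!*[n∸k]!]≡n! (m≤m+n j (j + 0)))
    N+j∸2j≡N∸j : N + j ∸ 2 * j ≡ N ∸ j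
    N+j∸2j≡N∸j = begin
      N + j ∸ (j + (j + 0)) ≡⟨ ∸-+-assoc (N + j) j (j + 0) ⟨
      N + j ∸ j ∸ (j + 0)   ≡⟨ cong₂ _∸_ (m+n∸n≡m N j) (+-identityʳ j) ⟩
      N ∸ j                 ∎
    2j≤N+j : 2 * j ≤ N + j
    2j≤N+j = subst (λ x → j + x ≤ N + j) (sym (+-identityʳ j))
      (≤-trans (+-monoˡ-≤ j j≤N∸j) (+-monoˡ-≤ j (m∸n≤m N j)))

  multinomial-diagonal : ∀ n → multinomial (2 * n) n ≡ ((2 * n) C n) * ((3 * n) C n)
  multinomial-diagonal n = begin
    ((2 * n + n) C (2 * n)) * ((2 * n) C n) * ((2 * n ∸ n) C n)
      ≡⟨ cong₂ (λ x y → x * ((2 * n) C n) * y) [2n+n]C[2n]≡[3n]Cn [2n∸n]Cn≡1 ⟩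
    ((3 * n) C n) * ((2 * n) C n) * 1
      ≡⟨ *-identityʳ _ ⟩
    ((3 * n) C n) * ((2 * n) C n)
      ≡⟨ *-comm ((3 * n) C n) _ ⟩
    ((2 * n) C n) * ((3 * n) C n) ∎
    where
    2n+n≡3n : ∀ n → 2 * n + n ≡ 3 * n
    2n+n≡3n = solve-∀
    [2n+n]C[2n]≡[3n]Cn : (2 * n + n) C (2 * n) ≡ (3 * n) C n
    [2n+n]C[2n]≡[3n]Cn = trans ([m+n]Cm≡[m+n]Cn (2 * n) n) (cong (_C n) (2n+n≡3n n))
    [2n∸n]Cn≡1 : (2 * n ∸ n) C n ≡ 1
    [2n∸n]Cn≡1 = trans (cong (_C n) (2*n∸n≡n n)) (nCn≡1 n)

  multinomial-vanishes : ∀ {n j} → n < j → multinomial (2 * n) j ≡ 0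
  multinomial-vanishes {n} {j@(suc _)} n<j = begin
    c * ((2 * n ∸ j) C j) ≡⟨ cong (c *_) (k>n⇒nCk≡0 2n∸j<j) ⟩
    c * 0                 ≡⟨ *-zeroʳ c ⟩
    0                     ∎
    where
    c = ((2 * n + j) C (2 * j)) * ((2 * j) C j)
    2n<j+j : 2 * n < j + j
    2n<j+j = subst (2 * n <_) (cong (j +_) (+-identityʳ j)) (*-monoʳ-< 2 n<j)
    2n∸j<j : 2 * n ∸ j < j
    2n∸j<j = m<n+o⇒m∸n<o (2 * n) j 2n<j+j

  multinomial-step : ∀ a →
    6 * multinomial (2 * suc a) a ≡ suc a * suc a * multinomial (2 * suc a) (suc a)
  multinomial-step a = *-cancelʳ-≡ _ _ (a ! * a ! * a ! * n) {{K≢0}} (trans left (sym right))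
    where
    n = suc a
    N = 2 * n
    K≢0 : NonZero (a ! * a ! * a ! * n)
    K≢0 = m*n≢0 _ _ {{m*n≢0 _ _ {{a !* a !≢0}} {{a !≢0}}}}
    N≡a+[a+2] : ∀ a → 2 * suc a ≡ a + (a + 2)
    N≡a+[a+2] = solve-∀
    N∸a≡a+2 : N ∸ a ≡ a + 2
    N∸a≡a+2 = trans (cong (_∸ a) (N≡a+[a+2] a)) (m+n∸m≡n a (a + 2))
    N∸n∸n≡0 : N ∸ n ∸ n ≡ 0
    N∸n∸n≡0 = trans (cong (_∸ n) (2*n∸n≡n n)) (n∸n≡0 n)
    1+N+a≡3n : ∀ a → suc (2 * suc a + a) ≡ 3 * suc a
    1+N+a≡3n = solve-∀
    regroupˡ : ∀ M x n → 6 * M * (x * x * x * n) ≡ 3 * n * (M * (x * x * x * 2))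
    regroupˡ = solve-∀
    regroupʳ : ∀ M x n → n * n * M * (x * x * x * n) ≡ M * (n * x * (n * x) * (n * x) * 1)
    regroupʳ = solve-∀
    left : 6 * multinomial N a * (a ! * a ! * a ! * n) ≡ 3 * n * (N + a) !
    left = begin
      6 * multinomial N a * (a ! * a ! * a ! * n)    ≡⟨ regroupˡ (multinomial N a) (a !) n ⟩
      3 * n * (multinomial N a * (a ! * a ! * a ! * 2)) ≡⟨ cong (3 * n *_) (subst
        (λ x → multinomial N a * (a ! * a ! * a ! * x !) ≡ (N + a) !)
        (trans (cong (_∸ a) N∸a≡a+2) (m+n∸m≡n a 2))
        (multinomial-factorial N a (subst (a ≤_) (sym N∸a≡a+2) (m≤m+n a 2)))) ⟩
      3 * n * (N + a) !                              ∎
    right : n * n * multinomial N n * (a ! * a ! * a ! * n) ≡ 3 * n * (N + a) !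
    right = begin
      n * n * multinomial N n * (a ! * a ! * a ! * n)      ≡⟨ regroupʳ (multinomial N n) (a !) n ⟩
      multinomial N n * (n ! * n ! * n ! * 1)              ≡⟨ subst
        (λ x → multinomial N n * (n ! * n ! * n ! * x !) ≡ (N + n) !) N∸n∸n≡0
        (multinomial-factorial N n (subst (n ≤_) (sym (2*n∸n≡n n)) ≤-refl)) ⟩
      (N + n) !                                            ≡⟨ cong _! (+-suc N a) ⟩
      suc (N + a) * (N + a) !                              ≡⟨ cong (_* (N + a) !) (1+N+a≡3n a) ⟩
      3 * n * (N + a) !                                    ∎

open import Defs
open import Data.Nat as ℕ using (ℕ; zero; suc; _∸_; _≤_; _<_; z≤n; s≤s; NonZero)
import Data.Nat.Properties as ℕₚ
open import Data.Nat.Combinatorics using (_C_; k>n⇒nCk≡0; nCk+nC[k+1]≡[n+1]C[k+1])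
open import Data.Integer using (ℤ; +_; _+_; _*_; -_; _-_; 0ℤ; _^_)
import Data.Integer.Properties as ℤₚ
open import Data.Integer.Tactic.RingSolver using (solve-∀)
open import Algebra.Properties.CommutativeSemigroup ℤₚ.*-commutativeSemigroup
  using (xy∙z≈xz∙y; x∙yz≈y∙xz)
open import Data.Product using (_×_; _,_)
open import Relation.Binary.PropositionalEquality
open ≡-Reasoning
open BinomialCoefficients

-- Finite sums

∑ : ℕ → (ℕ → ℤ) → ℤ
∑ zero    f = 0ℤ
∑ (suc n) f = ∑ n f + f n

infixr 9 ∑
syntax ∑ n (λ i → e) = ∑[ i < n ] e

∑-cong : ∀ n {f g : ℕ → ℤ} → (∀ i → i < n → f i ≡ g i) → ∑ n f ≡ ∑ n g
∑-cong zero    f≗g = refl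
∑-cong (suc n) f≗g =
  cong₂ _+_ (∑-cong n (λ i i<n → f≗g i (ℕₚ.m<n⇒m<1+n i<n))) (f≗g n ℕₚ.≤-refl)

∑-vanishes : ∀ n (f : ℕ → ℤ) → (∀ i → i < n → f i ≡ 0ℤ) → ∑ n f ≡ 0ℤ
∑-vanishes zero    f f≗0 = refl
∑-vanishes (suc n) f f≗0 =
  cong₂ _+_ (∑-vanishes n f (λ i i<n → f≗0 i (ℕₚ.m<n⇒m<1+n i<n))) (f≗0 n ℕₚ.≤-refl)

∑-distrib-+ : ∀ n (f g : ℕ → ℤ) → ∑[ i < n ] (f i + g i) ≡ ∑ n f + ∑ n g
∑-distrib-+ zero    f g = refl
∑-distrib-+ (suc n) f g = begin
  ∑[ i < n ] (f i + g i) + (f n + g n) ≡⟨ cong (_+ (f n + g n)) (∑-distrib-+ n f g) ⟩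
  ∑ n f + ∑ n g + (f n + g n)          ≡⟨ middle-swap (∑ n f) (∑ n g) (f n) (g n) ⟩
  ∑ n f + f n + (∑ n g + g n)          ∎
  where
  middle-swap : ∀ a b c d → a + b + (c + d) ≡ a + c + (b + d)
  middle-swap = solve-∀

*-distribˡ-∑ : ∀ n c (f : ℕ → ℤ) → c * ∑ n f ≡ ∑[ i < n ] (c * f i)
*-distribˡ-∑ zero    c f = ℤₚ.*-zeroʳ c
*-distribˡ-∑ (suc n) c f = trans (ℤₚ.*-distribˡ-+ c (∑ n f) (f n)) (cong (_+ c * f n) (*-distribˡ-∑ n c f))

neg-distrib-∑ : ∀ n (f : ℕ → ℤ) → - ∑ n f ≡ ∑[ i < n ] (- f i)
neg-distrib-∑ zero    f = refl
neg-distrib-∑ (suc n) f = trans (ℤₚ.neg-distrib-+ (∑ n f) (f n)) (cong (_+ - f n) (neg-distrib-∑ n f))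

∑-split : ∀ m n (f : ℕ → ℤ) → ∑ (m ℕ.+ n) f ≡ ∑ m f + ∑[ i < n ] f (m ℕ.+ i)
∑-split m zero    f = trans (cong (λ k → ∑ k f) (ℕₚ.+-identityʳ m)) (sym (ℤₚ.+-identityʳ (∑ m f)))
∑-split m (suc n) f = begin
  ∑ (m ℕ.+ suc n) f                                ≡⟨ cong (λ k → ∑ k f) (ℕₚ.+-suc m n) ⟩
  ∑ (m ℕ.+ n) f + f (m ℕ.+ n)                      ≡⟨ cong (_+ f (m ℕ.+ n)) (∑-split m n f) ⟩
  ∑ m f + ∑[ i < n ] f (m ℕ.+ i) + f (m ℕ.+ n)      ≡⟨ ℤₚ.+-assoc (∑ m f) _ _ ⟩
  ∑ m f + (∑[ i < n ] f (m ℕ.+ i) + f (m ℕ.+ n))    ∎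

∑-head : ∀ n (f : ℕ → ℤ) → ∑ (suc n) f ≡ f 0 + ∑[ i < n ] f (suc i)
∑-head n f = trans (∑-split 1 n f) (cong (_+ ∑[ i < n ] f (suc i)) (ℤₚ.+-identityˡ (f 0)))

∑-comm : ∀ m n (f : ℕ → ℕ → ℤ) → ∑[ i < m ] ∑[ j < n ] f i j ≡ ∑[ j < n ] ∑[ i < m ] f i j
∑-comm zero    n f = sym (∑-vanishes n _ (λ _ _ → refl))
∑-comm (suc m) n f = begin
  ∑[ i < m ] ∑[ j < n ] f i j + ∑[ j < n ] f m j   ≡⟨ cong (_+ ∑[ j < n ] f m j) (∑-comm m n f) ⟩
  ∑[ j < n ] ∑[ i < m ] f i j + ∑[ j < n ] f m j   ≡⟨ ∑-distrib-+ n _ _ ⟨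
  ∑[ j < n ] (∑[ i < m ] f i j + f m j)            ∎

∑-drop : ∀ n k (f : ℕ → ℤ) → k ≤ n → (∀ i → i < k → f i ≡ 0ℤ) →
  ∑ n f ≡ ∑[ t < n ∸ k ] f (k ℕ.+ t)
∑-drop n k f k≤n below = begin
  ∑ n f                               ≡⟨ cong (λ m → ∑ m f) (ℕₚ.m+[n∸m]≡n k≤n) ⟨
  ∑ (k ℕ.+ (n ∸ k)) f                 ≡⟨ ∑-split k (n ∸ k) f ⟩
  ∑ k f + ∑[ t < n ∸ k ] f (k ℕ.+ t)  ≡⟨ cong (_+ ∑[ t < n ∸ k ] f (k ℕ.+ t)) (∑-vanishes k f below) ⟩
  0ℤ + ∑[ t < n ∸ k ] f (k ℕ.+ t)     ≡⟨ ℤₚ.+-identityˡ _ ⟩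
  ∑[ t < n ∸ k ] f (k ℕ.+ t)          ∎

∑-truncate : ∀ n l (f : ℕ → ℤ) → l ≤ n → (∀ i → l ≤ i → i < n → f i ≡ 0ℤ) →
  ∑ n f ≡ ∑ l f
∑-truncate n l f l≤n above = begin
  ∑ n f                                   ≡⟨ cong (λ m → ∑ m f) (ℕₚ.m+[n∸m]≡n l≤n) ⟨
  ∑ (l ℕ.+ (n ∸ l)) f                     ≡⟨ ∑-split l (n ∸ l) f ⟩
  ∑ l f + ∑[ t < n ∸ l ] f (l ℕ.+ t)      ≡⟨ cong (_+_ (∑ l f)) (∑-vanishes (n ∸ l) _ beyond) ⟩
  ∑ l f + 0ℤ                              ≡⟨ ℤₚ.+-identityʳ (∑ l f) ⟩
  ∑ l f                                   ∎
  where
  beyond : ∀ t → t < n ∸ l → f (l ℕ.+ t) ≡ 0ℤ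
  beyond t t<n∸l = above (l ℕ.+ t) (ℕₚ.m≤m+n l t) (m<n∸o⇒o+m<n n l t<n∸l)

∑-window : ∀ n k l (f : ℕ → ℤ) → k ℕ.+ l ≤ n →
  (∀ i → i < k → f i ≡ 0ℤ) → (∀ i → k ℕ.+ l ≤ i → i < n → f i ≡ 0ℤ) →
  ∑ n f ≡ ∑[ t < l ] f (k ℕ.+ t)
∑-window n k l f k+l≤n below above =
  trans (∑-drop n k f (ℕₚ.m+n≤o⇒m≤o k k+l≤n) below)
        (∑-truncate (n ∸ k) l (λ t → f (k ℕ.+ t)) l≤n∸k above-shifted)
  where
  l≤n∸k = ℕₚ.m+n≤o⇒m≤o∸n l (subst (_≤ n) (ℕₚ.+-comm k l) k+l≤n)
  above-shifted : ∀ t → l ≤ t → t < n ∸ k → f (k ℕ.+ t) ≡ 0ℤ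
  above-shifted t l≤t t<n∸k = above (k ℕ.+ t) (ℕₚ.+-monoʳ-≤ k l≤t) (m<n∸o⇒o+m<n n k t<n∸k)

∑-recurrence : ∀ (g h : ℕ → ℤ) → h 0 ≡ 0ℤ → (∀ j → h (suc j) ≡ h j + g j) →
  ∀ n → h n ≡ ∑ n g
∑-recurrence g h h0 hsuc zero    = h0
∑-recurrence g h h0 hsuc (suc n) = trans (hsuc n) (cong (_+ g n) (∑-recurrence g h h0 hsuc n))

-- sumFromTo recurses through a local function, so it is identified with ∑ by its recurrence.
sumFromTo≡∑ : ∀ a b f → sumFromTo a b f ≡ ∑[ i < suc b ∸ a ] f (a ℕ.+ i)
sumFromTo≡∑ a b f with ∑-recurrence (λ i → f (a ℕ.+ i)) _ refl (λ _ → refl) | suc b ∸ a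
... | h≡∑ | w = h≡∑ w

sumFromTo-cong : ∀ a b {f g : ℕ → ℤ} → (∀ k → f k ≡ g k) → sumFromTo a b f ≡ sumFromTo a b g
sumFromTo-cong a b {f} {g} f≗g = begin
  sumFromTo a b f                 ≡⟨ sumFromTo≡∑ a b f ⟩
  ∑[ i < suc b ∸ a ] f (a ℕ.+ i)  ≡⟨ ∑-cong (suc b ∸ a) (λ i _ → f≗g (a ℕ.+ i)) ⟩
  ∑[ i < suc b ∸ a ] g (a ℕ.+ i)  ≡⟨ sumFromTo≡∑ a b g ⟨
  sumFromTo a b g                 ∎

sumFromTo-singleton : ∀ n (f : ℕ → ℤ) → sumFromTo n n f ≡ f n
sumFromTo-singleton n f = begin
  sumFromTo n n f                      ≡⟨ sumFromTo≡∑ n n f ⟩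
  ∑[ i < suc n ∸ n ] f (n ℕ.+ i)       ≡⟨ cong (λ l → ∑[ i < l ] f (n ℕ.+ i)) (ℕₚ.m+n∸n≡m 1 n) ⟩
  0ℤ + f (n ℕ.+ 0)                     ≡⟨ ℤₚ.+-identityˡ _ ⟩
  f (n ℕ.+ 0)                          ≡⟨ cong f (ℕₚ.+-identityʳ n) ⟩
  f n                                  ∎

sumFromTo-pair : ∀ n (f : ℕ → ℤ) → sumFromTo n (suc n) f ≡ f n + f (suc n)
sumFromTo-pair n f = begin
  sumFromTo n (suc n) f                 ≡⟨ sumFromTo≡∑ n (suc n) f ⟩
  ∑[ i < suc (suc n) ∸ n ] f (n ℕ.+ i)  ≡⟨ cong (λ l → ∑[ i < l ] f (n ℕ.+ i)) (ℕₚ.m+n∸n≡m 2 n) ⟩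
  0ℤ + f (n ℕ.+ 0) + f (n ℕ.+ 1)        ≡⟨ cong (_+ f (n ℕ.+ 1)) (ℤₚ.+-identityˡ (f (n ℕ.+ 0))) ⟩
  f (n ℕ.+ 0) + f (n ℕ.+ 1)             ≡⟨ cong₂ (λ i j → f i + f j) (ℕₚ.+-identityʳ n) (ℕₚ.+-comm n 1) ⟩
  f n + f (suc n)                       ∎

sign-homo-+ : ∀ m n → sign (m ℕ.+ n) ≡ sign m * sign n
sign-homo-+ zero    n = sym (ℤₚ.*-identityˡ (sign n))
sign-homo-+ (suc m) n = trans (cong -_ (sign-homo-+ m n)) (ℤₚ.neg-distribˡ-* (sign m) (sign n))

-- Binomial coefficients as integers

-- Opaque, so that unification treats B n k as an atom instead of unfolding n C k.
opaque
  B : ℕ → ℕ → ℤ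
  B n k = + (n C k)

  B≡+C : ∀ n k → B n k ≡ + (n C k)
  B≡+C n k = refl

Bn0≡1 : ∀ n → B n 0 ≡ + 1
Bn0≡1 n = B≡+C n 0

k>n⇒Bnk≡0 : ∀ {n k} → n < k → B n k ≡ 0ℤ
k>n⇒Bnk≡0 {n} {k} n<k = trans (B≡+C n k) (cong +_ (k>n⇒nCk≡0 n<k))

B-pascal : ∀ n k → B (suc n) (suc k) ≡ B n k + B n (suc k)
B-pascal n k = begin
  B (suc n) (suc k)         ≡⟨ B≡+C (suc n) (suc k) ⟩
  + (suc n C suc k)         ≡⟨ cong +_ (nCk+nC[k+1]≡[n+1]C[k+1] n k) ⟨
  + ((n C k) ℕ.+ (n C suc k)) ≡⟨ ℤₚ.pos-+ (n C k) _ ⟩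
  + (n C k) + + (n C suc k) ≡⟨ cong₂ _+_ (B≡+C n k) (B≡+C n (suc k)) ⟨
  B n k + B n (suc k)       ∎

B-absorb : ∀ n k → + suc k * B (suc n) (suc k) ≡ + suc n * B n k
B-absorb n k = begin
  + suc k * B (suc n) (suc k)       ≡⟨ cong (+ suc k *_) (B≡+C (suc n) (suc k)) ⟩
  + suc k * + (suc n C suc k)       ≡⟨ ℤₚ.pos-* (suc k) _ ⟨
  + (suc k ℕ.* (suc n C suc k))     ≡⟨ cong +_ ([1+k]*[1+n]C[1+k]≡[1+n]*nCk n k) ⟩
  + (suc n ℕ.* (n C k))             ≡⟨ ℤₚ.pos-* (suc n) _ ⟩
  + suc n * + (n C k)               ≡⟨ cong (+ suc n *_) (B≡+C n k) ⟨
  + suc n * B n k                   ∎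

C*C≡C*C⇒B*B≡B*B : ∀ {n k m l p q r s} → (n C k) ℕ.* (m C l) ≡ (p C q) ℕ.* (r C s) →
  B n k * B m l ≡ B p q * B r s
C*C≡C*C⇒B*B≡B*B {n} {k} {m} {l} {p} {q} {r} {s} eq = begin
  B n k * B m l             ≡⟨ cong₂ _*_ (B≡+C n k) (B≡+C m l) ⟩
  + (n C k) * + (m C l)     ≡⟨ ℤₚ.pos-* (n C k) _ ⟨
  + ((n C k) ℕ.* (m C l))   ≡⟨ cong +_ eq ⟩
  + ((p C q) ℕ.* (r C s))   ≡⟨ ℤₚ.pos-* (p C q) _ ⟩
  + (p C q) * + (r C s)     ≡⟨ cong₂ _*_ (B≡+C p q) (B≡+C r s) ⟨
  B p q * B r s             ∎

-- Any bound L > m will do, as the terms with t > m vanish; this lets the induction on m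
-- proceed without trimming sums.
vandermonde : ∀ L m n c → m < L → ∑[ t < L ] (B m t * B n (c ℕ.+ t)) ≡ B (m ℕ.+ n) (m ℕ.+ c)
vandermonde (suc L) zero n c _ = begin
  ∑[ t < suc L ] (B 0 t * B n (c ℕ.+ t))                          ≡⟨ ∑-head L _ ⟩
  B 0 0 * B n (c ℕ.+ 0) + ∑[ t < L ] (B 0 (suc t) * B n (c ℕ.+ suc t))
    ≡⟨ cong₂ _+_ (trans (cong (_* B n (c ℕ.+ 0)) (Bn0≡1 0)) (ℤₚ.*-identityˡ _))
                 (∑-vanishes L _ (λ t _ → cong (_* B n (c ℕ.+ suc t)) (k>n⇒Bnk≡0 (s≤s z≤n)))) ⟩
  B n (c ℕ.+ 0) + 0ℤ                                              ≡⟨ ℤₚ.+-identityʳ (B n (c ℕ.+ 0)) ⟩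
  B n (c ℕ.+ 0)                                                   ≡⟨ cong (B n) (ℕₚ.+-identityʳ c) ⟩
  B n c                                                           ∎
vandermonde (suc L) (suc m) n c (s≤s m<L) = begin
  ∑[ t < suc L ] (B (suc m) t * X t)
    ≡⟨ ∑-head L _ ⟩
  B (suc m) 0 * X 0 + ∑[ t < L ] (B (suc m) (suc t) * X (suc t))
    ≡⟨ cong (λ b → b * X 0 + ∑[ t < L ] (B (suc m) (suc t) * X (suc t)))
            (trans (Bn0≡1 (suc m)) (sym (Bn0≡1 m))) ⟩
  B m 0 * X 0 + ∑[ t < L ] (B (suc m) (suc t) * X (suc t))
    ≡⟨ cong (_+_ (B m 0 * X 0)) (trans (∑-cong L λ t _ → pascal t) (∑-distrib-+ L _ _)) ⟩
  B m 0 * X 0 + (∑[ t < L ] (B m t * X (suc t)) + ∑[ t < L ] (B m (suc t) * X (suc t)))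
    ≡⟨ x+[y+z]≡y+[x+z] (B m 0 * X 0) (∑[ t < L ] (B m t * X (suc t))) _ ⟩
  ∑[ t < L ] (B m t * X (suc t)) + (B m 0 * X 0 + ∑[ t < L ] (B m (suc t) * X (suc t)))
    ≡⟨ cong₂ _+_ shifted (sym (∑-head L _)) ⟩
  B (m ℕ.+ n) (suc (m ℕ.+ c)) + ∑[ t < suc L ] (B m t * X t)
    ≡⟨ cong (_+_ (B (m ℕ.+ n) (suc (m ℕ.+ c)))) (vandermonde (suc L) m n c (ℕₚ.m<n⇒m<1+n m<L)) ⟩
  B (m ℕ.+ n) (suc (m ℕ.+ c)) + B (m ℕ.+ n) (m ℕ.+ c)
    ≡⟨ ℤₚ.+-comm (B (m ℕ.+ n) (suc (m ℕ.+ c))) _ ⟩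
  B (m ℕ.+ n) (m ℕ.+ c) + B (m ℕ.+ n) (suc (m ℕ.+ c))
    ≡⟨ B-pascal (m ℕ.+ n) (m ℕ.+ c) ⟨
  B (suc m ℕ.+ n) (suc m ℕ.+ c) ∎
  where
  X : ℕ → ℤ
  X t = B n (c ℕ.+ t)
  pascal : ∀ t → B (suc m) (suc t) * X (suc t) ≡ B m t * X (suc t) + B m (suc t) * X (suc t)
  pascal t = trans (cong (_* X (suc t)) (B-pascal m t)) (ℤₚ.*-distribʳ-+ (X (suc t)) (B m t) _)
  x+[y+z]≡y+[x+z] : ∀ x y z → x + (y + z) ≡ y + (x + z)
  x+[y+z]≡y+[x+z] = solve-∀
  shifted : ∑[ t < L ] (B m t * X (suc t)) ≡ B (m ℕ.+ n) (suc (m ℕ.+ c))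
  shifted = begin
    ∑[ t < L ] (B m t * X (suc t))          ≡⟨ ∑-cong L (λ t _ → cong (λ x → B m t * B n x) (ℕₚ.+-suc c t)) ⟩
    ∑[ t < L ] (B m t * B n (suc c ℕ.+ t))  ≡⟨ vandermonde L m n (suc c) m<L ⟩
    B (m ℕ.+ n) (m ℕ.+ suc c)               ≡⟨ cong (B (m ℕ.+ n)) (ℕₚ.+-suc m c) ⟩
    B (m ℕ.+ n) (suc (m ℕ.+ c))             ∎

vandermonde₀ : ∀ L m n → m < L → ∑[ t < L ] (B m t * B n t) ≡ B (m ℕ.+ n) m
vandermonde₀ L m n m<L = trans (vandermonde L m n 0 m<L) (cong (B (m ℕ.+ n)) (ℕₚ.+-identityʳ m))

∑BBB≡B*B : ∀ a b i → i ≤ a →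
  ∑[ j < suc a ] (B a j * B b j * B j i) ≡ B a i * B (a ℕ.+ b ∸ i) a
∑BBB≡B*B a b i i≤a = begin
  ∑[ j < suc a ] g j
    ≡⟨ ∑-drop (suc a) i g (ℕₚ.m≤n⇒m≤1+n i≤a) below ⟩
  ∑[ t < suc a ∸ i ] g (i ℕ.+ t)
    ≡⟨ ∑-cong (suc a ∸ i) regroup ⟩
  ∑[ t < suc a ∸ i ] (B a i * (B (a ∸ i) t * B b (i ℕ.+ t)))
    ≡⟨ *-distribˡ-∑ (suc a ∸ i) (B a i) _ ⟨
  B a i * ∑[ t < suc a ∸ i ] (B (a ∸ i) t * B b (i ℕ.+ t))
    ≡⟨ cong (B a i *_) (vandermonde (suc a ∸ i) (a ∸ i) b i a∸i<1+a∸i) ⟩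
  B a i * B (a ∸ i ℕ.+ b) (a ∸ i ℕ.+ i)
    ≡⟨ cong₂ (λ x y → B a i * B x y) (sym (ℕₚ.+-∸-comm b i≤a)) (ℕₚ.m∸n+n≡m i≤a) ⟩
  B a i * B (a ℕ.+ b ∸ i) a ∎
  where
  g : ℕ → ℤ
  g j = B a j * B b j * B j i
  below : ∀ j → j < i → g j ≡ 0ℤ
  below j j<i = trans (cong (B a j * B b j *_) (k>n⇒Bnk≡0 j<i)) (ℤₚ.*-zeroʳ (B a j * B b j))
  a∸i<1+a∸i : a ∸ i < suc a ∸ i
  a∸i<1+a∸i = ℕₚ.≤-reflexive (sym (ℕₚ.+-∸-assoc 1 i≤a))
  regroup : ∀ t → t < suc a ∸ i → g (i ℕ.+ t) ≡ B a i * (B (a ∸ i) t * B b (i ℕ.+ t))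
  regroup t _ = begin
    B a (i ℕ.+ t) * B b (i ℕ.+ t) * B (i ℕ.+ t) i
      ≡⟨ xy∙z≈xz∙y (B a (i ℕ.+ t)) _ _ ⟩
    B a (i ℕ.+ t) * B (i ℕ.+ t) i * B b (i ℕ.+ t)
      ≡⟨ cong (_* B b (i ℕ.+ t)) (C*C≡C*C⇒B*B≡B*B (nCi*[n∸i]Ct≡nC[i+t]*[i+t]Ci a i t)) ⟨
    B a i * B (a ∸ i) t * B b (i ℕ.+ t)
      ≡⟨ ℤₚ.*-assoc (B a i) _ _ ⟩
    B a i * (B (a ∸ i) t * B b (i ℕ.+ t)) ∎

B*∑BBB≡B*B*B : ∀ a b i → i ≤ a →
  B (a ℕ.+ b) i * ∑[ j < suc a ] (B a j * B b j * B j i) ≡ B (a ℕ.+ b) a * (B a i * B b i)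
B*∑BBB≡B*B*B a b i i≤a = begin
  B s i * ∑[ j < suc a ] (B a j * B b j * B j i)
    ≡⟨ cong (B s i *_) (∑BBB≡B*B a b i i≤a) ⟩
  B s i * (B a i * B (s ∸ i) a)
    ≡⟨ x∙yz≈y∙xz (B s i) (B a i) _ ⟩
  B a i * (B s i * B (s ∸ i) a)
    ≡⟨ cong (B a i *_) (C*C≡C*C⇒B*B≡B*B (nCi*[n∸i]Ct≡nCt*[n∸t]Ci s i a)) ⟩
  B a i * (B s a * B (s ∸ a) i)
    ≡⟨ cong (λ x → B a i * (B s a * B x i)) (ℕₚ.m+n∸m≡n a b) ⟩
  B a i * (B s a * B b i)
    ≡⟨ x∙yz≈y∙xz (B a i) (B s a) _ ⟩
  B s a * (B a i * B b i) ∎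
  where s = a ℕ.+ b

B²-expansion : ∀ a b →
  ∑[ j < suc a ] (B a j * B b j * B (a ℕ.+ b ℕ.+ j) j) ≡ B (a ℕ.+ b) a * B (a ℕ.+ b) a
B²-expansion a b = begin
  ∑[ j < suc a ] (B a j * B b j * B (s ℕ.+ j) j)
    ≡⟨ ∑-cong (suc a) (λ j j<1+a → cong (B a j * B b j *_) (expand j j<1+a)) ⟩
  ∑[ j < suc a ] (B a j * B b j * ∑[ i < suc a ] (B j i * B s i))
    ≡⟨ ∑-cong (suc a) (λ j _ → *-distribˡ-∑ (suc a) (B a j * B b j) _) ⟩
  ∑[ j < suc a ] ∑[ i < suc a ] (B a j * B b j * (B j i * B s i))
    ≡⟨ ∑-comm (suc a) (suc a) _ ⟩
  ∑[ i < suc a ] ∑[ j < suc a ] (B a j * B b j * (B j i * B s i))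
    ≡⟨ ∑-cong (suc a) (λ i i<1+a → collapse i (ℕₚ.≤-pred i<1+a)) ⟩
  ∑[ i < suc a ] (B s a * (B a i * B b i))
    ≡⟨ *-distribˡ-∑ (suc a) (B s a) _ ⟨
  B s a * ∑[ i < suc a ] (B a i * B b i)
    ≡⟨ cong (B s a *_) (vandermonde₀ (suc a) a b ℕₚ.≤-refl) ⟩
  B s a * B s a ∎
  where
  s = a ℕ.+ b
  expand : ∀ j → j < suc a → B (s ℕ.+ j) j ≡ ∑[ i < suc a ] (B j i * B s i)
  expand j j<1+a = sym (trans (vandermonde₀ (suc a) j s j<1+a) (cong (λ x → B x j) (ℕₚ.+-comm j s)))
  xy∙zw≈w∙xyz : ∀ x y z w → x * y * (z * w) ≡ w * (x * y * z)
  xy∙zw≈w∙xyz = solve-∀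
  collapse : ∀ i → i ≤ a → ∑[ j < suc a ] (B a j * B b j * (B j i * B s i)) ≡ B s a * (B a i * B b i)
  collapse i i≤a = begin
    ∑[ j < suc a ] (B a j * B b j * (B j i * B s i))
      ≡⟨ ∑-cong (suc a) (λ j _ → xy∙zw≈w∙xyz (B a j) (B b j) (B j i) (B s i)) ⟩
    ∑[ j < suc a ] (B s i * (B a j * B b j * B j i))
      ≡⟨ *-distribˡ-∑ (suc a) (B s i) _ ⟨
    B s i * ∑[ j < suc a ] (B a j * B b j * B j i)
      ≡⟨ B*∑BBB≡B*B*B a b i i≤a ⟩
    B s a * (B a i * B b i) ∎

B³-expansion : ∀ N k → k ≤ N →
  B N k * (B N k * B N k) ≡ ∑[ j < suc N ] (B N k * B k j * B (N ∸ k) j * B (N ℕ.+ j) j)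
B³-expansion N k k≤N = begin
  B N k * (B N k * B N k)
    ≡⟨ cong (λ x → B N k * (B x k * B x k)) k+[N∸k]≡N ⟨
  B N k * (B (k ℕ.+ (N ∸ k)) k * B (k ℕ.+ (N ∸ k)) k)
    ≡⟨ cong (B N k *_) (B²-expansion k (N ∸ k)) ⟨
  B N k * ∑[ j < suc k ] (B k j * B (N ∸ k) j * B (k ℕ.+ (N ∸ k) ℕ.+ j) j)
    ≡⟨ cong (B N k *_) (∑-cong (suc k) λ j _ →
         cong (λ x → B k j * B (N ∸ k) j * B (x ℕ.+ j) j) k+[N∸k]≡N) ⟩
  B N k * ∑[ j < suc k ] (B k j * B (N ∸ k) j * B (N ℕ.+ j) j)
    ≡⟨ cong (B N k *_) (∑-truncate (suc N) (suc k) _ (s≤s k≤N) beyond) ⟨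
  B N k * ∑[ j < suc N ] (B k j * B (N ∸ k) j * B (N ℕ.+ j) j)
    ≡⟨ *-distribˡ-∑ (suc N) (B N k) _ ⟩
  ∑[ j < suc N ] (B N k * (B k j * B (N ∸ k) j * B (N ℕ.+ j) j))
    ≡⟨ ∑-cong (suc N) (λ j _ → x∙yzw≈xyzw (B N k) (B k j) _ _) ⟩
  ∑[ j < suc N ] (B N k * B k j * B (N ∸ k) j * B (N ℕ.+ j) j) ∎
  where
  k+[N∸k]≡N = ℕₚ.m+[n∸m]≡n k≤N
  x∙yzw≈xyzw : ∀ x y z w → x * (y * z * w) ≡ x * y * z * w
  x∙yzw≈xyzw = solve-∀
  beyond : ∀ j → suc k ≤ j → j < suc N → B k j * B (N ∸ k) j * B (N ℕ.+ j) j ≡ 0ℤ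
  beyond j k<j _ = cong (λ x → x * B (N ∸ k) j * B (N ℕ.+ j) j) (k>n⇒Bnk≡0 k<j)

-- Alternating sums and finite differences

∑-alternating-pascal : ∀ M (g : ℕ → ℤ) →
  ∑[ p < suc (suc M) ] (sign p * B (suc M) p * g p) ≡ ∑[ p < suc M ] (sign p * B M p * (g p - g (suc p)))
∑-alternating-pascal M g = begin
  ∑[ p < suc (suc M) ] (sign p * B (suc M) p * g p)
    ≡⟨ ∑-head (suc M) _ ⟩
  sign 0 * B (suc M) 0 * g 0 + ∑[ p < suc M ] (sign (suc p) * B (suc M) (suc p) * g (suc p))
    ≡⟨ cong₂ _+_ (cong (λ b → sign 0 * b * g 0) (trans (Bn0≡1 (suc M)) (sym (Bn0≡1 M))))
                 (trans (∑-cong (suc M) (λ p _ → split p)) (∑-distrib-+ (suc M) down up)) ⟩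
  sign 0 * B M 0 * g 0 + (∑ (suc M) down + ∑ (suc M) up)
    ≡⟨ x+[y+z]≡[x+z]+y (sign 0 * B M 0 * g 0) (∑ (suc M) down) (∑ (suc M) up) ⟩
  (sign 0 * B M 0 * g 0 + ∑ (suc M) up) + ∑ (suc M) down
    ≡⟨ cong (_+ ∑ (suc M) down) (∑-head (suc M) (λ p → sign p * B M p * g p)) ⟨
  ∑[ p < suc (suc M) ] (sign p * B M p * g p) + ∑ (suc M) down
    ≡⟨ cong (_+ ∑ (suc M) down) top-vanishes ⟩
  ∑[ p < suc M ] (sign p * B M p * g p) + ∑ (suc M) down
    ≡⟨ ∑-distrib-+ (suc M) (λ p → sign p * B M p * g p) down ⟨
  ∑[ p < suc M ] (sign p * B M p * g p + down p)
    ≡⟨ ∑-cong (suc M) (λ p _ → sbx+-sby≡sb[x-y] (sign p) (B M p) (g p) (g (suc p))) ⟩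
  ∑[ p < suc M ] (sign p * B M p * (g p - g (suc p))) ∎
  where
  down up : ℕ → ℤ
  down p = - (sign p * B M p * g (suc p))
  up   p = sign (suc p) * B M (suc p) * g (suc p)
  split : ∀ p → sign (suc p) * B (suc M) (suc p) * g (suc p) ≡ down p + up p
  split p = trans (cong (λ b → - sign p * b * g (suc p)) (B-pascal M p))
                  (distrib (sign p) (B M p) (B M (suc p)) (g (suc p)))
    where
    distrib : ∀ s x y z → - s * (x + y) * z ≡ - (s * x * z) + - s * y * z
    distrib = solve-∀
  x+[y+z]≡[x+z]+y : ∀ x y z → x + (y + z) ≡ (x + z) + y
  x+[y+z]≡[x+z]+y = solve-∀
  top-vanishes : ∑[ p < suc (suc M) ] (sign p * B M p * g p) ≡ ∑[ p < suc M ] (sign p * B M p * g p)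
  top-vanishes = begin
    ∑[ p < suc M ] (sign p * B M p * g p) + sign (suc M) * B M (suc M) * g (suc M)
      ≡⟨ cong (λ b → ∑[ p < suc M ] (sign p * B M p * g p) + sign (suc M) * b * g (suc M))
              (k>n⇒Bnk≡0 (ℕₚ.n<1+n M)) ⟩
    ∑[ p < suc M ] (sign p * B M p * g p) + sign (suc M) * 0ℤ * g (suc M)
      ≡⟨ x+s0y≡x (∑[ p < suc M ] (sign p * B M p * g p)) (sign (suc M)) (g (suc M)) ⟩
    ∑[ p < suc M ] (sign p * B M p * g p) ∎
    where
    x+s0y≡x : ∀ x s y → x + s * 0ℤ * y ≡ x
    x+s0y≡x = solve-∀
  sbx+-sby≡sb[x-y] : ∀ s b x y → s * b * x + - (s * b * y) ≡ s * b * (x - y)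
  sbx+-sby≡sb[x-y] = solve-∀

∑-alternating-absorption : ∀ M (g : ℕ → ℤ) →
  ∑[ p < suc (suc M) ] (sign p * B (suc M) p * (+ p * g p))
    ≡ - (+ suc M * ∑[ p < suc M ] (sign p * B M p * g (suc p)))
∑-alternating-absorption M g = begin
  ∑[ p < suc (suc M) ] (sign p * B (suc M) p * (+ p * g p))
    ≡⟨ ∑-head (suc M) _ ⟩
  sign 0 * B (suc M) 0 * (0ℤ * g 0) + ∑[ p < suc M ] (sign (suc p) * B (suc M) (suc p) * (+ suc p * g (suc p)))
    ≡⟨ cong₂ _+_ (ℤₚ.*-zeroʳ (sign 0 * B (suc M) 0)) (∑-cong (suc M) (λ p _ → absorb p)) ⟩
  0ℤ + ∑[ p < suc M ] (- (+ suc M * (sign p * B M p * g (suc p))))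
    ≡⟨ ℤₚ.+-identityˡ _ ⟩
  ∑[ p < suc M ] (- (+ suc M * (sign p * B M p * g (suc p))))
    ≡⟨ neg-distrib-∑ (suc M) _ ⟨
  - ∑[ p < suc M ] (+ suc M * (sign p * B M p * g (suc p)))
    ≡⟨ cong -_ (*-distribˡ-∑ (suc M) (+ suc M) _) ⟨
  - (+ suc M * ∑[ p < suc M ] (sign p * B M p * g (suc p))) ∎
  where
  absorb : ∀ p → sign (suc p) * B (suc M) (suc p) * (+ suc p * g (suc p))
                   ≡ - (+ suc M * (sign p * B M p * g (suc p)))
  absorb p = begin
    - sign p * B (suc M) (suc p) * (+ suc p * g (suc p))
      ≡⟨ regroup (sign p) (B (suc M) (suc p)) (+ suc p) (g (suc p)) ⟩
    - (sign p * (+ suc p * B (suc M) (suc p)) * g (suc p))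
      ≡⟨ cong (λ x → - (sign p * x * g (suc p))) (B-absorb M p) ⟩
    - (sign p * (+ suc M * B M p) * g (suc p))
      ≡⟨ cong -_ (regroup′ (sign p) (+ suc M) (B M p) (g (suc p))) ⟩
    - (+ suc M * (sign p * B M p * g (suc p))) ∎
    where
    regroup : ∀ s b q y → - s * b * (q * y) ≡ - (s * (q * b) * y)
    regroup = solve-∀
    regroup′ : ∀ s k b y → s * (k * b) * y ≡ k * (s * b * y)
    regroup′ = solve-∀

-- (−1)^M times the M-th forward difference of x ↦ x^m at c.
Δ : ℕ → ℕ → ℕ → ℤ
Δ M c m = ∑[ p < suc M ] (sign p * B M p * (+ (c ℕ.+ p)) ^ m)

Δ-pow-suc : ∀ M c m → Δ (suc M) c (suc m) ≡ + c * Δ (suc M) c m - + suc M * Δ M (suc c) m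
Δ-pow-suc M c m = begin
  ∑[ p < suc (suc M) ] (sign p * B (suc M) p * (+ (c ℕ.+ p) * X p))
    ≡⟨ ∑-cong (suc (suc M)) (λ p _ → expand (sign p) (B (suc M) p) (+ c) (+ p) (X p)) ⟩
  ∑[ p < suc (suc M) ] (+ c * (sign p * B (suc M) p * X p) + sign p * B (suc M) p * (+ p * X p))
    ≡⟨ ∑-distrib-+ (suc (suc M)) _ _ ⟩
  ∑[ p < suc (suc M) ] (+ c * (sign p * B (suc M) p * X p)) + ∑[ p < suc (suc M) ] (sign p * B (suc M) p * (+ p * X p))
    ≡⟨ cong₂ _+_ (sym (*-distribˡ-∑ (suc (suc M)) (+ c) _)) (∑-alternating-absorption M X) ⟩
  + c * Δ (suc M) c m - + suc M * ∑[ p < suc M ] (sign p * B M p * X (suc p))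
    ≡⟨ cong (λ x → + c * Δ (suc M) c m - + suc M * x) shift ⟩
  + c * Δ (suc M) c m - + suc M * Δ M (suc c) m ∎
  where
  X : ℕ → ℤ
  X p = (+ (c ℕ.+ p)) ^ m
  expand : ∀ s b x y z → s * b * ((x + y) * z) ≡ x * (s * b * z) + s * b * (y * z)
  expand = solve-∀
  shift : ∑[ p < suc M ] (sign p * B M p * X (suc p)) ≡ Δ M (suc c) m
  shift = ∑-cong (suc M) (λ p _ → cong (λ x → sign p * B M p * (+ x) ^ m) (ℕₚ.+-suc c p))

Δ-vanishes : ∀ {m M} c → m < M → Δ M c m ≡ 0ℤ
Δ-vanishes {zero} {suc M} c _ = begin
  Δ (suc M) c 0
    ≡⟨ ∑-alternating-pascal M (λ _ → + 1) ⟩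
  ∑[ p < suc M ] (sign p * B M p * (+ 1 - + 1))
    ≡⟨ ∑-vanishes (suc M) _ (λ p _ → ℤₚ.*-zeroʳ (sign p * B M p)) ⟩
  0ℤ ∎
Δ-vanishes {suc m} {suc M} c (s≤s m<M) = begin
  Δ (suc M) c (suc m)                             ≡⟨ Δ-pow-suc M c m ⟩
  + c * Δ (suc M) c m - + suc M * Δ M (suc c) m   ≡⟨ cong₂ (λ x y → + c * x - + suc M * y)
                                                       (Δ-vanishes c (ℕₚ.m<n⇒m<1+n m<M)) (Δ-vanishes (suc c) m<M) ⟩
  + c * 0ℤ - + suc M * 0ℤ                         ≡⟨ cx-dy≡0 (+ c) (+ suc M) ⟩
  0ℤ                                              ∎
  where
  cx-dy≡0 : ∀ x y → x * 0ℤ - y * 0ℤ ≡ 0ℤ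
  cx-dy≡0 = solve-∀

Δ[0,c,m]≡c^m : ∀ c m → Δ 0 c m ≡ (+ c) ^ m
Δ[0,c,m]≡c^m c m = begin
  0ℤ + sign 0 * B 0 0 * (+ (c ℕ.+ 0)) ^ m
    ≡⟨ ℤₚ.+-identityˡ _ ⟩
  sign 0 * B 0 0 * (+ (c ℕ.+ 0)) ^ m
    ≡⟨ cong₂ (λ b x → sign 0 * b * (+ x) ^ m) (Bn0≡1 0) (ℕₚ.+-identityʳ c) ⟩
  + 1 * + 1 * (+ c) ^ m
    ≡⟨ ℤₚ.*-identityˡ _ ⟩
  (+ c) ^ m ∎

Δ[2,c,2]≡2 : ∀ c → Δ 2 c 2 ≡ + 2
Δ[2,c,2]≡2 c = begin
  ∑[ p < 3 ] (sign p * B 2 p * (+ (c ℕ.+ p)) ^ 2)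
    ≡⟨ ∑-cong 3 (λ p _ → cong₂ (λ b x → sign p * b * x ^ 2) (B≡+C 2 p) (ℤₚ.pos-+ c p)) ⟩
  ∑[ p < 3 ] (sign p * + (2 C p) * (+ c + + p) ^ 2)
    ≡⟨ second-difference (+ c) ⟩
  + 2 ∎
  where
  second-difference : ∀ x →
    0ℤ + + 1 * + 1 * ((x + + 0) * ((x + + 0) * + 1)) + - + 1 * + 2 * ((x + + 1) * ((x + + 1) * + 1))
       + + 1 * + 1 * ((x + + 2) * ((x + + 2) * + 1)) ≡ + 2
  second-difference = solve-∀

-- Regrouping the double sum

pos-multinomial : ∀ N j →
  + multinomial N j ≡ + ((N ℕ.+ j) C (2 ℕ.* j)) * + ((2 ℕ.* j) C j) * + ((N ∸ j) C j)
pos-multinomial N j = trans (ℤₚ.pos-* (c₁ ℕ.* c₂) c₃) (cong (_* + c₃) (ℤₚ.pos-* c₁ c₂))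
  where
  c₁ = (N ℕ.+ j) C (2 ℕ.* j)
  c₂ = (2 ℕ.* j) C j
  c₃ = (N ∸ j) C j

-- Both sides are the multinomial coefficient (N + j)! / (j! j! j! p! (N − 2j − p)!).
B-regroup : ∀ N j p →
  B N (j ℕ.+ p) * B (j ℕ.+ p) j * B (N ∸ (j ℕ.+ p)) j * B (N ℕ.+ j) j ≡ + multinomial N j * B (N ∸ j ∸ j) p
B-regroup N j p = sym (begin
  + multinomial N j * B (N ∸ j ∸ j) p
    ≡⟨ cong (_* B (N ∸ j ∸ j) p) (pos-multinomial N j) ⟩
  + ((N ℕ.+ j) C (2 ℕ.* j)) * + ((2 ℕ.* j) C j) * + ((N ∸ j) C j) * B (N ∸ j ∸ j) p
    ≡⟨ cong₂ (λ x y → x * y * B (N ∸ j ∸ j) p)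
             (cong₂ _*_ (B≡+C (N ℕ.+ j) (2 ℕ.* j)) (B≡+C (2 ℕ.* j) j)) (B≡+C (N ∸ j) j) ⟨
  B (N ℕ.+ j) (2 ℕ.* j) * B (2 ℕ.* j) j * B (N ∸ j) j * B (N ∸ j ∸ j) p
    ≡⟨ xyzw≡xy∙zw (B (N ℕ.+ j) (2 ℕ.* j)) (B (2 ℕ.* j) j) (B (N ∸ j) j) _ ⟩
  B (N ℕ.+ j) (2 ℕ.* j) * B (2 ℕ.* j) j * (B (N ∸ j) j * B (N ∸ j ∸ j) p)
    ≡⟨ cong₂ _*_ outer (C*C≡C*C⇒B*B≡B*B (nCi*[n∸i]Ct≡nC[i+t]*[i+t]Ci (N ∸ j) j p)) ⟩
  B (N ℕ.+ j) j * B N j * (B (N ∸ j) k * B k j)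
    ≡⟨ xy∙zw≡xw∙yz (B (N ℕ.+ j) j) (B N j) (B (N ∸ j) k) (B k j) ⟩
  B (N ℕ.+ j) j * B k j * (B N j * B (N ∸ j) k)
    ≡⟨ cong (B (N ℕ.+ j) j * B k j *_) (C*C≡C*C⇒B*B≡B*B (nCi*[n∸i]Ct≡nCt*[n∸t]Ci N j k)) ⟩
  B (N ℕ.+ j) j * B k j * (B N k * B (N ∸ k) j)
    ≡⟨ xy∙zw≡zyw∙x (B (N ℕ.+ j) j) (B k j) (B N k) (B (N ∸ k) j) ⟩
  B N k * B k j * B (N ∸ k) j * B (N ℕ.+ j) j ∎)
  where
  k = j ℕ.+ p
  xyzw≡xy∙zw : ∀ x y z w → x * y * z * w ≡ x * y * (z * w)
  xyzw≡xy∙zw = solve-∀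
  xy∙zw≡xw∙yz : ∀ x y z w → x * y * (z * w) ≡ x * w * (y * z)
  xy∙zw≡xw∙yz = solve-∀
  xy∙zw≡zyw∙x : ∀ x y z w → x * y * (z * w) ≡ z * y * w * x
  xy∙zw≡zyw∙x = solve-∀
  outer : B (N ℕ.+ j) (2 ℕ.* j) * B (2 ℕ.* j) j ≡ B (N ℕ.+ j) j * B N j
  outer = begin
    B (N ℕ.+ j) (2 ℕ.* j) * B (2 ℕ.* j) j
      ≡⟨ cong (λ i → B (N ℕ.+ j) i * B i j) (cong (j ℕ.+_) (ℕₚ.+-identityʳ j)) ⟩
    B (N ℕ.+ j) (j ℕ.+ j) * B (j ℕ.+ j) j
      ≡⟨ C*C≡C*C⇒B*B≡B*B (nCi*[n∸i]Ct≡nC[i+t]*[i+t]Ci (N ℕ.+ j) j j) ⟨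
    B (N ℕ.+ j) j * B (N ℕ.+ j ∸ j) j
      ≡⟨ cong (λ n → B (N ℕ.+ j) j * B n j) (ℕₚ.m+n∸n≡m N j) ⟩
    B (N ℕ.+ j) j * B N j ∎

∑-column : ∀ N m j → j ≤ N →
  ∑[ k < suc N ] (sign k * (+ k) ^ m * (B N k * B k j * B (N ∸ k) j * B (N ℕ.+ j) j))
    ≡ sign j * + multinomial N j * Δ (N ∸ j ∸ j) j m
∑-column N m j j≤N = begin
  ∑[ k < suc N ] t k
    ≡⟨ ∑-drop (suc N) j t (ℕₚ.m≤n⇒m≤1+n j≤N) below ⟩
  ∑[ p < suc N ∸ j ] t (j ℕ.+ p)
    ≡⟨ ∑-cong (suc N ∸ j) (λ p _ → regroup p) ⟩
  ∑[ p < suc N ∸ j ] (sign j * + multinomial N j * (sign p * B R p * X (j ℕ.+ p)))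
    ≡⟨ *-distribˡ-∑ (suc N ∸ j) (sign j * + multinomial N j) _ ⟨
  sign j * + multinomial N j * ∑[ p < suc N ∸ j ] (sign p * B R p * X (j ℕ.+ p))
    ≡⟨ cong (sign j * + multinomial N j *_) (∑-truncate (suc N ∸ j) (suc R) _ R<1+N∸j beyond) ⟩
  sign j * + multinomial N j * Δ R j m ∎
  where
  R = N ∸ j ∸ j
  X : ℕ → ℤ
  X k = (+ k) ^ m
  t : ℕ → ℤ
  t k = sign k * X k * (B N k * B k j * B (N ∸ k) j * B (N ℕ.+ j) j)
  below : ∀ k → k < j → t k ≡ 0ℤ
  below k k<j = trans (cong (λ b → sign k * X k * (B N k * b * B (N ∸ k) j * B (N ℕ.+ j) j)) (k>n⇒Bnk≡0 k<j))
                      (sx[a0cd]≡0 (sign k) (X k) (B N k) (B (N ∸ k) j) (B (N ℕ.+ j) j))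
    where
    sx[a0cd]≡0 : ∀ s x a c d → s * x * (a * 0ℤ * c * d) ≡ 0ℤ
    sx[a0cd]≡0 = solve-∀
  regroup : ∀ p → t (j ℕ.+ p) ≡ sign j * + multinomial N j * (sign p * B R p * X (j ℕ.+ p))
  regroup p = begin
    sign (j ℕ.+ p) * X (j ℕ.+ p) * (B N (j ℕ.+ p) * B (j ℕ.+ p) j * B (N ∸ (j ℕ.+ p)) j * B (N ℕ.+ j) j)
      ≡⟨ cong₂ (λ s b → s * X (j ℕ.+ p) * b) (sign-homo-+ j p) (B-regroup N j p) ⟩
    sign j * sign p * X (j ℕ.+ p) * (+ multinomial N j * B R p)
      ≡⟨ rearrange (sign j) (sign p) (X (j ℕ.+ p)) (+ multinomial N j) (B R p) ⟩
    sign j * + multinomial N j * (sign p * B R p * X (j ℕ.+ p)) ∎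
    where
    rearrange : ∀ s s′ x a b → s * s′ * x * (a * b) ≡ s * a * (s′ * b * x)
    rearrange = solve-∀
  R<1+N∸j : suc R ≤ suc N ∸ j
  R<1+N∸j = subst (suc R ≤_) (sym (ℕₚ.+-∸-assoc 1 j≤N)) (s≤s (ℕₚ.m∸n≤m (N ∸ j) j))
  beyond : ∀ p → suc R ≤ p → p < suc N ∸ j → sign p * B R p * X (j ℕ.+ p) ≡ 0ℤ
  beyond p R<p _ = cong (_* X (j ℕ.+ p))
    (trans (cong (sign p *_) (k>n⇒Bnk≡0 R<p)) (ℤₚ.*-zeroʳ (sign p)))

rhsTerm : ℕ → ℕ → ℕ → ℤ
rhsTerm n m j = sign j * + multinomial (2 ℕ.* n) j * Δ (2 ℕ.* (n ∸ j)) j m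

rhsTerm-vanishes-below : ∀ n m → .{{NonZero m}} → ∀ j → j < suc n ∸ m → rhsTerm n m j ≡ 0ℤ
rhsTerm-vanishes-below n m@(suc _) j j<1+n∸m =
  trans (cong (sign j * + multinomial (2 ℕ.* n) j *_) (Δ-vanishes j m<2[n∸j]))
        (ℤₚ.*-zeroʳ (sign j * + multinomial (2 ℕ.* n) j))
  where
  m≤n∸j = ℕₚ.m+n≤o⇒m≤o∸n m (ℕₚ.≤-pred (m<n∸o⇒o+m<n (suc n) m j<1+n∸m))
  m<2[n∸j] = ℕₚ.<-≤-trans (ℕₚ.m<m+n m (s≤s z≤n)) (ℕₚ.*-monoʳ-≤ 2 m≤n∸j)

rhsTerm-vanishes-above : ∀ n m j → n < j → rhsTerm n m j ≡ 0ℤ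
rhsTerm-vanishes-above n m j n<j = trans
  (cong (λ a → sign j * + a * Δ (2 ℕ.* (n ∸ j)) j m) (multinomial-vanishes n<j))
  (cong (_* Δ (2 ℕ.* (n ∸ j)) j m) (ℤₚ.*-zeroʳ (sign j)))

rhsTerm-diagonal : ∀ n m → rhsTerm n m n ≡ sign n * + multinomial (2 ℕ.* n) n * (+ n) ^ m
rhsTerm-diagonal n m = cong (sign n * + multinomial (2 ℕ.* n) n *_)
  (trans (cong (λ r → Δ (2 ℕ.* r) n m) (ℕₚ.n∸n≡0 n)) (Δ[0,c,m]≡c^m n m))

rhsTerm-subdiagonal : ∀ a → rhsTerm (suc a) 2 a ≡ sign a * + multinomial (2 ℕ.* suc a) a * + 2
rhsTerm-subdiagonal a = cong (sign a * + multinomial (2 ℕ.* suc a) a *_)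
  (trans (cong (λ r → Δ (2 ℕ.* r) a 2) (ℕₚ.m+n∸n≡m 1 a)) (Δ[2,c,2]≡2 a))

∑-moment : ∀ n m → .{{NonZero m}} →
  ∑[ k < suc (2 ℕ.* n) ] (sign k * (+ k) ^ m * (+ ((2 ℕ.* n) C k)) ^ 3)
    ≡ ∑[ t < suc n ∸ (suc n ∸ m) ] rhsTerm n m (suc n ∸ m ℕ.+ t)
∑-moment n m = begin
  ∑[ k < suc N ] (sign k * X k * (+ (N C k)) ^ 3)
    ≡⟨ ∑-cong (suc N) (λ k k<1+N → cube k (ℕₚ.≤-pred k<1+N)) ⟩
  ∑[ k < suc N ] ∑[ j < suc N ] t j k
    ≡⟨ ∑-comm (suc N) (suc N) (λ k j → t j k) ⟩
  ∑[ j < suc N ] ∑[ k < suc N ] t j k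
    ≡⟨ ∑-cong (suc N) (λ j j<1+N → column j (ℕₚ.≤-pred j<1+N)) ⟩
  ∑[ j < suc N ] rhsTerm n m j
    ≡⟨ ∑-window (suc N) k₀ (suc n ∸ k₀) (rhsTerm n m) k₀+l≤1+N (rhsTerm-vanishes-below n m) above ⟩
  ∑[ t < suc n ∸ k₀ ] rhsTerm n m (k₀ ℕ.+ t) ∎
  where
  N = 2 ℕ.* n
  k₀ = suc n ∸ m
  X : ℕ → ℤ
  X k = (+ k) ^ m
  t : ℕ → ℕ → ℤ
  t j k = sign k * X k * (B N k * B k j * B (N ∸ k) j * B (N ℕ.+ j) j)
  cube : ∀ k → k ≤ N → sign k * X k * (+ (N C k)) ^ 3 ≡ ∑[ j < suc N ] t j k
  cube k k≤N = begin
    sign k * X k * (+ (N C k)) ^ 3         ≡⟨ cong (λ b → sign k * X k * b ^ 3) (B≡+C N k) ⟨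
    sign k * X k * B N k ^ 3               ≡⟨ cong (sign k * X k *_) (x³≡x[xx] (B N k)) ⟩
    sign k * X k * (B N k * (B N k * B N k)) ≡⟨ cong (sign k * X k *_) (B³-expansion N k k≤N) ⟩
    sign k * X k * ∑[ j < suc N ] (B N k * B k j * B (N ∸ k) j * B (N ℕ.+ j) j)
                                           ≡⟨ *-distribˡ-∑ (suc N) (sign k * X k) _ ⟩
    ∑[ j < suc N ] t j k                   ∎
    where
    x³≡x[xx] : ∀ x → x * (x * (x * + 1)) ≡ x * (x * x)
    x³≡x[xx] = solve-∀
  column : ∀ j → j ≤ N → ∑[ k < suc N ] t j k ≡ rhsTerm n m j
  column j j≤N = trans (∑-column N m j j≤N)
    (cong (λ r → sign j * + multinomial N j * Δ r j m) (2*n∸j∸j≡2*[n∸j] n j))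
  k₀+l≤1+N : k₀ ℕ.+ (suc n ∸ k₀) ≤ suc N
  k₀+l≤1+N = subst (_≤ suc N) (sym (ℕₚ.m+[n∸m]≡n (ℕₚ.m∸n≤m (suc n) m))) (s≤s (ℕₚ.m≤m+n n (n ℕ.+ 0)))
  above : ∀ j → k₀ ℕ.+ (suc n ∸ k₀) ≤ j → j < suc N → rhsTerm n m j ≡ 0ℤ
  above j k₀+l≤j _ = rhsTerm-vanishes-above n m j
    (subst (_≤ j) (ℕₚ.m+[n∸m]≡n (ℕₚ.m∸n≤m (suc n) m)) k₀+l≤j)

rhsSummand : ℕ → ℕ → ℕ → ℤ
rhsSummand n m k =
  sign k * + ((2 ℕ.* n ℕ.+ k) C (2 ℕ.* k)) * + ((2 ℕ.* k) C k) * + ((2 ℕ.* n ∸ k) C k)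
    * sumFromTo 0 (2 ℕ.* (n ∸ k)) (λ p → sign p * + ((2 ℕ.* (n ∸ k)) C p) * ((+ (k ℕ.+ p)) ^ m))

rhsSummand≡rhsTerm : ∀ n m k → rhsSummand n m k ≡ rhsTerm n m k
rhsSummand≡rhsTerm n m k = cong₂ _*_ coefficient inner-sum
  where
  M = 2 ℕ.* (n ∸ k)
  s[abc]≡sabc : ∀ s a b c → s * (a * b * c) ≡ s * a * b * c
  s[abc]≡sabc = solve-∀
  coefficient : sign k * + ((2 ℕ.* n ℕ.+ k) C (2 ℕ.* k)) * + ((2 ℕ.* k) C k) * + ((2 ℕ.* n ∸ k) C k)
                  ≡ sign k * + multinomial (2 ℕ.* n) k
  coefficient = sym (trans (cong (sign k *_) (pos-multinomial (2 ℕ.* n) k)) (s[abc]≡sabc (sign k) _ _ _))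
  inner-sum : sumFromTo 0 M (λ p → sign p * + (M C p) * ((+ (k ℕ.+ p)) ^ m)) ≡ Δ M k m
  inner-sum = trans (sumFromTo≡∑ 0 M _)
    (∑-cong (suc M) (λ p _ → cong (λ b → sign p * b * (+ (k ℕ.+ p)) ^ m) (sym (B≡+C M p))))

moment-identity : ∀ (n m : ℕ) → .{{_ : NonZero m}} →
  sumFromTo 0 (2 ℕ.* n) (λ k → sign k * ((+ k) ^ m) * ((+ ((2 ℕ.* n) C k)) ^ 3))
    ≡ sumFromTo (suc n ∸ m) n (rhsSummand n m)
moment-identity n m = begin
  sumFromTo 0 (2 ℕ.* n) (λ k → sign k * (+ k) ^ m * (+ ((2 ℕ.* n) C k)) ^ 3)
    ≡⟨ sumFromTo≡∑ 0 (2 ℕ.* n) _ ⟩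
  ∑[ k < suc (2 ℕ.* n) ] (sign k * (+ k) ^ m * (+ ((2 ℕ.* n) C k)) ^ 3)
    ≡⟨ ∑-moment n m ⟩
  ∑[ t < suc n ∸ k₀ ] rhsTerm n m (k₀ ℕ.+ t)
    ≡⟨ ∑-cong (suc n ∸ k₀) (λ t _ → rhsSummand≡rhsTerm n m (k₀ ℕ.+ t)) ⟨
  ∑[ t < suc n ∸ k₀ ] rhsSummand n m (k₀ ℕ.+ t)
    ≡⟨ sumFromTo≡∑ k₀ n (rhsSummand n m) ⟨
  sumFromTo k₀ n (rhsSummand n m) ∎
  where k₀ = suc n ∸ m

first-moment : ∀ (n : ℕ) →
  sumFromTo 0 (2 ℕ.* n) (λ k → sign k * + k * ((+ ((2 ℕ.* n) C k)) ^ 3))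
    ≡ sign n * + n * + ((2 ℕ.* n) C n) * + ((3 ℕ.* n) C n)
first-moment n = begin
  sumFromTo 0 (2 ℕ.* n) (λ k → sign k * + k * ((+ ((2 ℕ.* n) C k)) ^ 3))
    ≡⟨ sumFromTo-cong 0 (2 ℕ.* n) (λ k →
         cong (λ x → sign k * x * (+ ((2 ℕ.* n) C k)) ^ 3) (sym (ℤₚ.^-identityʳ (+ k)))) ⟩
  sumFromTo 0 (2 ℕ.* n) (λ k → sign k * (+ k) ^ 1 * (+ ((2 ℕ.* n) C k)) ^ 3)
    ≡⟨ moment-identity n 1 ⟩
  sumFromTo n n (rhsSummand n 1)
    ≡⟨ sumFromTo-singleton n (rhsSummand n 1) ⟩
  rhsSummand n 1 n
    ≡⟨ rhsSummand≡rhsTerm n 1 n ⟩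
  rhsTerm n 1 n
    ≡⟨ rhsTerm-diagonal n 1 ⟩
  sign n * + multinomial (2 ℕ.* n) n * (+ n) ^ 1
    ≡⟨ cong (λ a → sign n * + a * (+ n) ^ 1) (multinomial-diagonal n) ⟩
  sign n * + (((2 ℕ.* n) C n) ℕ.* ((3 ℕ.* n) C n)) * (+ n) ^ 1
    ≡⟨ cong (λ x → sign n * x * (+ n) ^ 1) (ℤₚ.pos-* ((2 ℕ.* n) C n) _) ⟩
  sign n * (+ ((2 ℕ.* n) C n) * + ((3 ℕ.* n) C n)) * (+ n) ^ 1
    ≡⟨ rearrange (sign n) (+ ((2 ℕ.* n) C n)) (+ ((3 ℕ.* n) C n)) (+ n) ⟩
  sign n * + n * + ((2 ℕ.* n) C n) * + ((3 ℕ.* n) C n) ∎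
  where
  rearrange : ∀ s a b x → s * (a * b) * (x * + 1) ≡ s * x * a * b
  rearrange = solve-∀

second-moment : ∀ (n : ℕ) →
  + 3 * sumFromTo 0 (2 ℕ.* n) (λ k → sign k * ((+ k) ^ 2) * ((+ ((2 ℕ.* n) C k)) ^ 3))
    ≡ sign n * + 2 * ((+ n) ^ 2) * + ((2 ℕ.* n) C n) * + ((3 ℕ.* n) C n)
second-moment zero    = refl
second-moment (suc a) = begin
  + 3 * sumFromTo 0 N (λ k → sign k * (+ k) ^ 2 * (+ (N C k)) ^ 3)
    ≡⟨ cong (+ 3 *_) (moment-identity n 2) ⟩
  + 3 * sumFromTo a n (rhsSummand n 2)
    ≡⟨ cong (+ 3 *_) (sumFromTo-pair a (rhsSummand n 2)) ⟩
  + 3 * (rhsSummand n 2 a + rhsSummand n 2 n)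
    ≡⟨ cong₂ (λ x y → + 3 * (x + y)) (trans (rhsSummand≡rhsTerm n 2 a) (rhsTerm-subdiagonal a))
                                      (trans (rhsSummand≡rhsTerm n 2 n) (rhsTerm-diagonal n 2)) ⟩
  + 3 * (sign a * Mₐ * + 2 + - sign a * Mₙ * (+ n) ^ 2)
    ≡⟨ combine (sign a) Mₐ Mₙ (+ n) 6Mₐ≡n²Mₙ ⟩
  - sign a * + 2 * (+ n) ^ 2 * Mₙ
    ≡⟨ cong (- sign a * + 2 * (+ n) ^ 2 *_)
            (trans (cong +_ (multinomial-diagonal n)) (ℤₚ.pos-* ((2 ℕ.* n) C n) _)) ⟩
  - sign a * + 2 * (+ n) ^ 2 * (+ (N C n) * + ((3 ℕ.* n) C n))
    ≡⟨ ℤₚ.*-assoc (- sign a * + 2 * (+ n) ^ 2) (+ (N C n)) _ ⟨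
  sign n * + 2 * (+ n) ^ 2 * + (N C n) * + ((3 ℕ.* n) C n) ∎
  where
  n = suc a
  N = 2 ℕ.* n
  Mₐ = + multinomial N a
  Mₙ = + multinomial N n
  6Mₐ≡n²Mₙ : + 6 * Mₐ ≡ + n * + n * Mₙ
  6Mₐ≡n²Mₙ = begin
    + 6 * Mₐ                         ≡⟨ ℤₚ.pos-* 6 (multinomial N a) ⟨
    + (6 ℕ.* multinomial N a)        ≡⟨ cong +_ (multinomial-step a) ⟩
    + (n ℕ.* n ℕ.* multinomial N n)  ≡⟨ ℤₚ.pos-* (n ℕ.* n) _ ⟩
    + (n ℕ.* n) * Mₙ                 ≡⟨ cong (_* Mₙ) (ℤₚ.pos-* n n) ⟩
    + n * + n * Mₙ                   ∎
  combine : ∀ s x y z → + 6 * x ≡ z * z * y →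
    + 3 * (s * x * + 2 + - s * y * (z * (z * + 1))) ≡ - s * + 2 * (z * (z * + 1)) * y
  combine s x y z 6x≡z²y = begin
    + 3 * (s * x * + 2 + - s * y * (z * (z * + 1))) ≡⟨ expand s x y z ⟩
    s * (+ 6 * x) - + 3 * s * (z * z * y)           ≡⟨ cong (λ w → s * w - + 3 * s * (z * z * y)) 6x≡z²y ⟩
    s * (z * z * y) - + 3 * s * (z * z * y)         ≡⟨ collect s y z ⟩
    - s * + 2 * (z * (z * + 1)) * y                 ∎
    where
    expand : ∀ s x y z → + 3 * (s * x * + 2 + - s * y * (z * (z * + 1))) ≡ s * (+ 6 * x) - + 3 * s * (z * z * y)
    expand = solve-∀
    collect : ∀ s y z → s * (z * z * y) - + 3 * s * (z * z * y) ≡ - s * + 2 * (z * (z * + 1)) * y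
    collect = solve-∀

proposition15 : (∀ (n m : ℕ) → .{{_ : NonZero m}} →
    sumFromTo 0 (2 ℕ.* n) (λ k → sign k * ((+ k) ^ m) * ((+ ((2 ℕ.* n) C k)) ^ 3))
      ≡ sumFromTo (suc n ∸ m) n (λ k →
          sign k * + ((2 ℕ.* n ℕ.+ k) C (2 ℕ.* k)) * + ((2 ℕ.* k) C k) * + ((2 ℕ.* n ∸ k) C k)
            * sumFromTo 0 (2 ℕ.* (n ∸ k)) (λ p →
                sign p * + ((2 ℕ.* (n ∸ k)) C p) * ((+ (k ℕ.+ p)) ^ m))))
  × (∀ (n : ℕ) →
    sumFromTo 0 (2 ℕ.* n) (λ k → sign k * + k * ((+ ((2 ℕ.* n) C k)) ^ 3))
      ≡ sign n * + n * + ((2 ℕ.* n) C n) * + ((3 ℕ.* n) C n))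
  × (∀ (n : ℕ) →
    + 3 * sumFromTo 0 (2 ℕ.* n) (λ k → sign k * ((+ k) ^ 2) * ((+ ((2 ℕ.* n) C k)) ^ 3))
      ≡ sign n * + 2 * ((+ n) ^ 2) * + ((2 ℕ.* n) C n) * + ((3 ℕ.* n) C n))
proposition15 = moment-identity , first-moment , second-moment
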